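{- For $r\in \mathbb{N}_0$ and $n\ge1$, the expected $r$th fringe size of a uniformly random simple two-dimensional lattice path of length $n$ is \[ \mathbb{E} X_{n;r}^{L} = 4^{r+1-n} \sum_{\lambda \geq 1} \frac{2\lambda^{3} + \lambda}{3} \bigg[\binom{2n-1}{n-2^{r}\lambda} - \binom{2n-1}{n - 2^{r}\lambda -1}\bigg], \] where binomial coefficients with negative lower index are $0$.
   Context: A simple two-dimensional lattice path of length $n\ge1$ is a word of length $n$ over $\{\uparrow,\rightarrow,\downarrow,\leftarrow\}$; all $4^n$ paths of length $n$ are equally likely. Horizontal steps are $\rightarrow,\leftarrow$, vertical steps $\uparrow,\downarrow$. The reduction $\Phi_L$ on paths of length $\ge2$: (1) if the path starts with a vertical step, rotate the whole path by $90^\circ$ clockwise; (2) if the resulting path ends with a horizontal step, rotate that last step by $90^\circ$ clockwise; the path then decomposes uniquely into segments, each a nonempty run of horizontal steps followed by a nonempty run of vertical steps; (3) replace each segment by $\nearrow$ (starts with $\rightarrow$, first vertical step $\uparrow$), $\searrow$ ($\rightarrow$, $\downarrow$), $\swarrow$ ($\leftarrow$, $\downarrow$), or $\nwarrow$ ($\leftarrow$, $\uparrow$); (4) rotate by $45^\circ$ clockwise: $\nearrow\mapsto\rightarrow$, $\searrow\mapsto\downarrow$, $\swarrow\mapsto\leftarrow$, $\nwarrow\mapsto\uparrow$. $\Phi_L$ is undefined on single steps. The $r$th fringe size $X^L_{n;r}$ of a path $\ell$ of length $n$ is the length of $\Phi_L^r(\ell)$ if $\Phi_L$ can be applied $r$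 times to $\ell$, and $0$ otherwise. -}

module Defs where

open import Data.Nat using (ℕ; zero; suc; _+_; _*_; _∸_; _^_; _<ᵇ_)
open import Data.Nat.Combinatorics using (_C_)
open import Data.Integer as ℤ using (ℤ; +_; -[1+_])
open import Data.List using (List; []; _∷_; length; map; concatMap)
open import Data.Nat.ListAction using (sum)
open import Data.Maybe using (Maybe; just; nothing)
open import Data.Bool using (Bool; true; false; if_then_else_)

-- The four unit steps: ↑ = U, → = R, ↓ = D, ← = L.
data Step : Set where
  U R D L : Step

Path : Set
Path = List Step

isH : Step → Bool
isH R = true
isH L = true
isH U = false
isH D = false

rotCW : Step → Step
rotCW U = R
rotCW R = D
rotCW D = L
rotCW L = U

step1 : Path → Path
step1 [] = []
step1 (x ∷ xs) = if isH x then x ∷ xs else map rotCW (x ∷ xs)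

fixLast : Path → Path
fixLast [] = []
fixLast (x ∷ []) = (if isH x then rotCW x else x) ∷ []
fixLast (x ∷ y ∷ zs) = x ∷ fixLast (y ∷ zs)

-- steps (3)+(4): a segment whose first (horizontal) step is h and whose
-- first vertical step is v becomes: (→,↑) ↗ ↦ →, (→,↓) ↘ ↦ ↓,
-- (←,↓) ↙ ↦ ←, (←,↑) ↖ ↦ ↑.  (Other combinations cannot occur.)
diag : Step → Step → Step
diag R U = R
diag R D = D
diag L D = L
diag L U = U
diag h v = h

mutual
  -- scanning the horizontal run of a segment, h = its first step
  inH : Step → Path → Path
  inH h [] = []
  inH h (y ∷ ys) = if isH y then inH h ys else diag h y ∷ inV ys

  -- scanning a vertical run (or at the start); a horizontal step starts a new segment
  inV : Path → Path
  inV [] = []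
  inV (y ∷ ys) = if isH y then inH y ys else inV ys

ΦL : Path → Maybe Path
ΦL [] = nothing
ΦL (x ∷ []) = nothing
ΦL (x ∷ y ∷ zs) = just (inV (fixLast (step1 (x ∷ y ∷ zs))))

fringe : ℕ → Path → ℕ
fringe zero p = length p
fringe (suc r) p with ΦL p
... | nothing = 0
... | just q = fringe r q

allPaths : ℕ → List Path
allPaths zero = [] ∷ []
allPaths (suc n) = concatMap (λ p → (U ∷ p) ∷ (R ∷ p) ∷ (D ∷ p) ∷ (L ∷ p) ∷ []) (allPaths n)

-- total fringe size over all paths of length n  (= 4^n · E X^L_{n;r})
totalFringe : ℕ → ℕ → ℕ
totalFringe n r = sum (map (fringe r) (allPaths n))

binomℤ : ℕ → ℤ → ℤ
binomℤ m (+ k) = + (m C k)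
binomℤ m -[1+ k ] = + 0

sumFrom1 : ℕ → (ℕ → ℤ) → ℤ
sumFrom1 zero f = + 0
sumFrom1 (suc N) f = sumFrom1 N f ℤ.+ f (suc N)

-- the summand (2λ³+λ)[C(2n-1, n-2^r λ) - C(2n-1, n-2^r λ-1)]  (without the 1/3)
summand : ℕ → ℕ → ℕ → ℤ
summand n r λ' =
  + (2 * λ' ^ 3 + λ')
    ℤ.* (binomℤ (2 * n ∸ 1) (+ n ℤ.- + (2 ^ r * λ'))
         ℤ.- binomℤ (2 * n ∸ 1) (+ n ℤ.- + (2 ^ r * λ') ℤ.- + 1))

-- Let T_r(n) be the total r-th fringe size over all 4^n paths of length n, and
-- b_k(m) = C(2k-1, k-m) - C(2k-1, k-m-1).  Splitting off the first step and tracking whether the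
-- scan of Φ_L is in a horizontal or a vertical run gives T_{r+1}(n+2) = 2 H_{n+1}(T_r), where H_m
-- is an explicit linear form in the values T_r(0), ..., T_r(m).  The numbers b_k satisfy the
-- Pascal-type rule b_{k+1}(m+1) = b_k(m) + 2 b_k(m+1) + b_k(m+2), and with it
-- H_{n+1}(k ↦ b_k(m)) = 2 b_{n+2}(2m): one reduction doubles the ballot index.  Since the formula
-- is a combination of the sequences k ↦ b_k(2^r λ), it propagates from r to r+1 by linearity.
-- For r = 0, T_0(n) = n 4^n, and the formula reduces to the moments Σ_μ μ b_k(μ) = 4^(k-1) and
-- Σ_μ (2μ³+μ) b_k(μ) = 3k 4^(k-1), both obtained by summation by parts against the Pascal rule.
module Submission where

open import Data.Integer using (ℤ; +_; -[1+_]; -_; _+_; _-_; _*_; _⊖_)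
import Data.Integer.Properties as ℤP
open import Data.Integer.Tactic.RingSolver using (solve-∀)
open import Data.List using (List; []; _∷_; _++_; map; concatMap; foldr; length)
open import Data.List.Properties using (map-++)
open import Data.Nat as ℕ using (ℕ; zero; suc; z≤n; s≤s)
import Data.Nat.Properties as ℕP
open import Data.Nat.Combinatorics using (_C_; nCk+nC[k+1]≡[n+1]C[k+1]; nCk≡nC[n∸k])
open import Data.Nat.ListAction using (sum)
open import Data.Nat.ListAction.Properties using (sum-++)
import Data.Nat.Tactic.RingSolver as ℕ-Solver
open import Data.Sum using (inj₁; inj₂)
open import Function using (_∘_)
open import Relation.Binary.PropositionalEquality
open ≡-Reasoning

open import Defs

binomℤ-pascal : ∀ N j → binomℤ (suc N) j ≡ binomℤ N (j - + 1) + binomℤ N j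
binomℤ-pascal N (+ zero)  = refl
binomℤ-pascal N (+ suc i) = cong +_ (sym (nCk+nC[k+1]≡[n+1]C[k+1] N i))
binomℤ-pascal N -[1+ i ]  = refl

binomΔ : ℕ → ℤ → ℤ
binomΔ N a = binomℤ N a - binomℤ N (a - + 1)

binomΔ-suc-suc : ∀ N a →
  binomΔ (suc (suc N)) a ≡ binomΔ N a + + 2 * binomΔ N (a - + 1) + binomΔ N (a - + 1 - + 1)
binomΔ-suc-suc N a = begin
    binomℤ (suc (suc N)) a - binomℤ (suc (suc N)) (a - + 1)
  ≡⟨ cong₂ _-_ (pascal² a) (pascal² (a - + 1)) ⟩
    b (a - + 1 - + 1) + b (a - + 1) + (b (a - + 1) + b a)
      - (b (a - + 1 - + 1 - + 1) + b (a - + 1 - + 1) + (b (a - + 1 - + 1) + b (a - + 1)))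
  ≡⟨ regroup (b (a - + 1 - + 1 - + 1)) (b (a - + 1 - + 1)) (b (a - + 1)) (b a) ⟩
    binomΔ N a + + 2 * binomΔ N (a - + 1) + binomΔ N (a - + 1 - + 1) ∎
  where
    b = binomℤ N
    pascal² : ∀ j → binomℤ (suc (suc N)) j ≡ b (j - + 1 - + 1) + b (j - + 1) + (b (j - + 1) + b j)
    pascal² j = trans (binomℤ-pascal (suc N) j) (cong₂ _+_ (binomℤ-pascal N (j - + 1)) (binomℤ-pascal N j))
    regroup : ∀ x y z w → y + z + (z + w) - (x + y + (y + z)) ≡ (w - z) + + 2 * (z - y) + (y - x)
    regroup = solve-∀

ballot : ℕ → ℕ → ℤ
ballot k m = binomΔ (2 ℕ.* k ℕ.∸ 1) (+ k - + m)

private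
  [1+a]-[1+b] : ∀ a b → + suc a - + suc b ≡ + a - + b
  [1+a]-[1+b] a b = begin
    + suc a - + suc b  ≡⟨ ℤP.m-n≡m⊖n (suc a) (suc b) ⟩
    suc a ⊖ suc b      ≡⟨ ℤP.[1+m]⊖[1+n]≡m⊖n a b ⟩
    a ⊖ b              ≡⟨ ℤP.m-n≡m⊖n a b ⟨
    + a - + b          ∎

  a-[1+b] : ∀ a b → + a - + suc b ≡ + a - + b - + 1
  a-[1+b] a b = trans (cong (λ z → + a - z) (ℤP.pos-+ 1 b)) (reassoc (+ a) (+ b))
    where
      reassoc : ∀ x y → x - (+ 1 + y) ≡ x - y - + 1
      reassoc = solve-∀

  2*[1+k]∸1 : ∀ k → 2 ℕ.* suc k ℕ.∸ 1 ≡ suc (2 ℕ.* k)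
  2*[1+k]∸1 k = cong (ℕ._∸ 1) (ℕP.*-suc 2 k)

ballot-suc : ∀ k m → ballot (suc k) (suc m) ≡ ballot k m + + 2 * ballot k (suc m) + ballot k (suc (suc m))
ballot-suc zero    zero    = refl
ballot-suc zero    (suc m) = refl
ballot-suc (suc k) m = begin
    binomΔ (2 ℕ.* suc (suc k) ℕ.∸ 1) (+ suc (suc k) - + suc m)
  ≡⟨ cong₂ binomΔ N+2 ([1+a]-[1+b] (suc k) m) ⟩
    binomΔ (suc (suc N)) a
  ≡⟨ binomΔ-suc-suc N a ⟩
    binomΔ N a + + 2 * binomΔ N (a - + 1) + binomΔ N (a - + 1 - + 1)
  ≡⟨ cong₂ (λ u v → binomΔ N a + + 2 * binomΔ N u + binomΔ N v) a-1 a-2 ⟨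
    ballot (suc k) m + + 2 * ballot (suc k) (suc m) + ballot (suc k) (suc (suc m)) ∎
  where
    N = 2 ℕ.* suc k ℕ.∸ 1
    a = + suc k - + m
    N+2 : 2 ℕ.* suc (suc k) ℕ.∸ 1 ≡ suc (suc N)
    N+2 = trans (2*[1+k]∸1 (suc k)) (cong suc (trans (ℕP.*-suc 2 k) (cong suc (sym (2*[1+k]∸1 k)))))
    a-1 : + suc k - + suc m ≡ a - + 1
    a-1 = a-[1+b] (suc k) m
    a-2 : + suc k - + suc (suc m) ≡ a - + 1 - + 1
    a-2 = trans (a-[1+b] (suc k) (suc m)) (cong (_- + 1) a-1)

ballot-suc-suc : ∀ k j → ballot (suc (suc k)) (suc (suc j)) ≡
  ballot k j + + 4 * ballot k (1 ℕ.+ j) + + 6 * ballot k (2 ℕ.+ j) + + 4 * ballot k (3 ℕ.+ j) + ballot k (4 ℕ.+ j)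
ballot-suc-suc k j
  rewrite ballot-suc (suc k) (suc j) | ballot-suc k j | ballot-suc k (suc j) | ballot-suc k (suc (suc j))
  = expand (ballot k j) (ballot k (1 ℕ.+ j)) (ballot k (2 ℕ.+ j)) (ballot k (3 ℕ.+ j)) (ballot k (4 ℕ.+ j))
  where
    expand : ∀ b₀ b₁ b₂ b₃ b₄ → b₀ + + 2 * b₁ + b₂ + + 2 * (b₁ + + 2 * b₂ + b₃) + (b₂ + + 2 * b₃ + b₄)
                              ≡ b₀ + + 4 * b₁ + + 6 * b₂ + + 4 * b₃ + b₄
    expand = solve-∀

ballot-zero : ∀ k → ballot (suc k) 0 ≡ + 0
ballot-zero k = begin
    binomΔ N (+ suc k - + 0)
  ≡⟨ cong (binomΔ N) (ℤP.+-identityʳ (+ suc k)) ⟩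
    + (N C suc k) - + (N C k)
  ≡⟨ cong (λ c → + c - + (N C k)) N-symmetric ⟩
    + (N C k) - + (N C k)
  ≡⟨ ℤP.+-inverseʳ (+ (N C k)) ⟩
    + 0 ∎
  where
    N = 2 ℕ.* suc k ℕ.∸ 1
    N≡k+[1+k] : N ≡ k ℕ.+ suc k
    N≡k+[1+k] = cong (k ℕ.+_) (ℕP.+-identityʳ (suc k))
    C-symmetric : ∀ a b → (a ℕ.+ b) C b ≡ (a ℕ.+ b) C a
    C-symmetric a b = trans (nCk≡nC[n∸k] (ℕP.m≤n+m b a)) (cong ((a ℕ.+ b) C_) (ℕP.m+n∸n≡m a b))
    N-symmetric : N C suc k ≡ N C k
    N-symmetric = subst (λ M → M C suc k ≡ M C k) (sym N≡k+[1+k]) (C-symmetric k (suc k))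

-- Both lower indices k - m and k - m - 1 are negative.
ballot-vanish : ∀ {k m} → k ℕ.< m → ballot k m ≡ + 0
ballot-vanish {k} {suc m} (s≤s k≤m) = cong (binomΔ (2 ℕ.* k ℕ.∸ 1)) k-[1+m]
  where
    k-[1+m] : + k - + suc m ≡ -[1+ m ℕ.∸ k ]
    k-[1+m] = begin
      + k - + suc m         ≡⟨ ℤP.m-n≡m⊖n k (suc m) ⟩
      k ⊖ suc m             ≡⟨ ℤP.⊖-< (s≤s k≤m) ⟩
      - + (suc m ℕ.∸ k)     ≡⟨ cong (λ z → - + z) (ℕP.+-∸-assoc 1 k≤m) ⟩
      -[1+ m ℕ.∸ k ]        ∎

sumFrom1-cong : ∀ B {f g : ℕ → ℤ} → (∀ μ → μ ℕ.< B → f (suc μ) ≡ g (suc μ)) → sumFrom1 B f ≡ sumFrom1 B g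
sumFrom1-cong zero    eq = refl
sumFrom1-cong (suc B) eq =
  cong₂ _+_ (sumFrom1-cong B (λ μ μ<B → eq μ (ℕP.m<n⇒m<1+n μ<B))) (eq B (ℕP.n<1+n B))

sumFrom1-+ : ∀ B (f g : ℕ → ℤ) → sumFrom1 B (λ μ → f μ + g μ) ≡ sumFrom1 B f + sumFrom1 B g
sumFrom1-+ zero    f g = refl
sumFrom1-+ (suc B) f g = trans (cong (_+ (f (suc B) + g (suc B))) (sumFrom1-+ B f g))
                               (interchange (sumFrom1 B f) (sumFrom1 B g) (f (suc B)) (g (suc B)))
  where
    interchange : ∀ a b c d → a + b + (c + d) ≡ a + c + (b + d)
    interchange = solve-∀

sumFrom1-*ˡ : ∀ B c (f : ℕ → ℤ) → sumFrom1 B (λ μ → c * f μ) ≡ c * sumFrom1 B f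
sumFrom1-*ˡ zero    c f = sym (ℤP.*-zeroʳ c)
sumFrom1-*ˡ (suc B) c f = trans (cong (_+ c * f (suc B)) (sumFrom1-*ˡ B c f)) (sym (ℤP.*-distribˡ-+ c _ _))

sumFrom1-121 : ∀ B (f g h : ℕ → ℤ) →
  sumFrom1 B (λ μ → f μ + + 2 * g μ + h μ) ≡ sumFrom1 B f + + 2 * sumFrom1 B g + sumFrom1 B h
sumFrom1-121 B f g h = begin
    sumFrom1 B (λ μ → f μ + + 2 * g μ + h μ)
  ≡⟨ sumFrom1-+ B _ h ⟩
    sumFrom1 B (λ μ → f μ + + 2 * g μ) + sumFrom1 B h
  ≡⟨ cong (_+ sumFrom1 B h) (trans (sumFrom1-+ B f _) (cong (λ z → sumFrom1 B f + z) (sumFrom1-*ˡ B (+ 2) g))) ⟩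
    sumFrom1 B f + + 2 * sumFrom1 B g + sumFrom1 B h ∎

sumFrom1-suc : ∀ B (f : ℕ → ℤ) → f 1 ≡ + 0 → sumFrom1 (suc B) f ≡ sumFrom1 B (f ∘ suc)
sumFrom1-suc zero    f f1≡0 = trans (ℤP.+-identityˡ (f 1)) f1≡0
sumFrom1-suc (suc B) f f1≡0 = cong (_+ f (suc (suc B))) (sumFrom1-suc B f f1≡0)

sumFrom1-tail : ∀ {A B} (f : ℕ → ℤ) → A ℕ.≤ B → (∀ μ → A ℕ.< μ → f μ ≡ + 0) → sumFrom1 B f ≡ sumFrom1 A f
sumFrom1-tail {A} {zero}  f z≤n f>A = refl
sumFrom1-tail {A} {suc B} f A≤1+B f>A with ℕP.m≤n⇒m<n∨m≡n A≤1+B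
... | inj₂ refl = refl
... | inj₁ (s≤s A≤B) = trans (cong₂ _+_ (sumFrom1-tail f A≤B f>A) (f>A (suc B) (s≤s A≤B))) (ℤP.+-identityʳ _)

-- The [1,2,1] smoothing; f (0 ∸ 1) = f 0, but it is only ever summed over μ ≥ 1.
smooth : (ℕ → ℤ) → ℕ → ℤ
smooth f μ = f (μ ℕ.∸ 1) + + 2 * f μ + f (suc μ)

-- Summation by parts: smoothing is self-adjoint on sequences vanishing at 0 and beyond K.
sumFrom1-smooth-swap : ∀ K (f d : ℕ → ℤ) → f 0 ≡ + 0 → d 0 ≡ + 0 → (∀ μ → K ℕ.< μ → d μ ≡ + 0) →
  sumFrom1 (suc K) (λ μ → f μ * smooth d μ) ≡ sumFrom1 K (λ μ → smooth f μ * d μ)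
sumFrom1-smooth-swap K f d f0 d0 d>K = begin
    sumFrom1 (suc K) (λ μ → f μ * smooth d μ)
  ≡⟨ sumFrom1-cong (suc K) (λ μ _ → distribˡ (f (suc μ)) (d μ) (d (suc μ)) (d (suc (suc μ)))) ⟩
    sumFrom1 (suc K) (λ μ → f μ * d (μ ℕ.∸ 1) + + 2 * (f μ * d μ) + f μ * d (suc μ))
  ≡⟨ sumFrom1-121 (suc K) _ _ _ ⟩
    lower + + 2 * diagonal + upper
  ≡⟨ cong₂ (λ a c → a + + 2 * diagonal + c) lower-shift upper-shift ⟩
    lower′ + + 2 * diagonal + upper′
  ≡⟨ cong (λ b → lower′ + + 2 * b + upper′) diagonal-tail ⟩
    lower′ + + 2 * diagonal′ + upper′
  ≡⟨ swap-ends lower′ diagonal′ upper′ ⟩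
    upper′ + + 2 * diagonal′ + lower′
  ≡⟨ sumFrom1-121 K _ _ _ ⟨
    sumFrom1 K (λ μ → f (μ ℕ.∸ 1) * d μ + + 2 * (f μ * d μ) + f (suc μ) * d μ)
  ≡⟨ sumFrom1-cong K (λ μ _ → distribʳ (f μ) (f (suc μ)) (f (suc (suc μ))) (d (suc μ))) ⟩
    sumFrom1 K (λ μ → smooth f μ * d μ) ∎
  where
    distribˡ : ∀ a x y z → a * (x + + 2 * y + z) ≡ a * x + + 2 * (a * y) + a * z
    distribˡ = solve-∀
    distribʳ : ∀ x y z a → x * a + + 2 * (y * a) + z * a ≡ (x + + 2 * y + z) * a
    distribʳ = solve-∀
    swap-ends : ∀ a b c → a + + 2 * b + c ≡ c + + 2 * b + a
    swap-ends = solve-∀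
    vanish : ∀ (g : ℕ → ℤ) μ → K ℕ.< μ → g μ * d μ ≡ + 0
    vanish g μ K<μ = trans (cong (g μ *_) (d>K μ K<μ)) (ℤP.*-zeroʳ (g μ))
    lower diagonal upper lower′ diagonal′ upper′ : ℤ
    lower     = sumFrom1 (suc K) (λ μ → f μ * d (μ ℕ.∸ 1))
    diagonal  = sumFrom1 (suc K) (λ μ → f μ * d μ)
    upper     = sumFrom1 (suc K) (λ μ → f μ * d (suc μ))
    lower′    = sumFrom1 K (λ μ → f (suc μ) * d μ)
    diagonal′ = sumFrom1 K (λ μ → f μ * d μ)
    upper′    = sumFrom1 K (λ μ → f (μ ℕ.∸ 1) * d μ)
    lower-shift : lower ≡ lower′
    lower-shift = sumFrom1-suc K _ (trans (cong (f 1 *_) d0) (ℤP.*-zeroʳ (f 1)))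
    diagonal-tail : diagonal ≡ diagonal′
    diagonal-tail = sumFrom1-tail _ (ℕP.n≤1+n K) (vanish f)
    upper-shift : upper ≡ upper′
    upper-shift = trans (sym (sumFrom1-suc (suc K) _ (trans (cong (_* d 1) f0) (ℤP.*-zeroˡ (d 1)))))
                        (sumFrom1-tail _ (ℕP.m≤n+m K 2) (vanish (λ μ → f (μ ℕ.∸ 1))))

ballotMoment : (ℕ → ℤ) → ℕ → ℤ
ballotMoment f k = sumFrom1 k (λ μ → f μ * ballot k μ)

ballotMoment-cong : ∀ (f g : ℕ → ℤ) k → (∀ μ → f (suc μ) ≡ g (suc μ)) → ballotMoment f k ≡ ballotMoment g k
ballotMoment-cong f g k eq = sumFrom1-cong k (λ μ _ → cong (_* ballot k (suc μ)) (eq μ))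

ballotMoment-+ : ∀ (f g : ℕ → ℤ) k → ballotMoment (λ μ → f μ + g μ) k ≡ ballotMoment f k + ballotMoment g k
ballotMoment-+ f g k = trans (sumFrom1-cong k (λ μ _ → ℤP.*-distribʳ-+ (ballot k (suc μ)) (f (suc μ)) (g (suc μ))))
                             (sumFrom1-+ k _ _)

ballotMoment-*ˡ : ∀ c (f : ℕ → ℤ) k → ballotMoment (λ μ → c * f μ) k ≡ c * ballotMoment f k
ballotMoment-*ˡ c f k = trans (sumFrom1-cong k (λ μ _ → ℤP.*-assoc c (f (suc μ)) (ballot k (suc μ))))
                              (sumFrom1-*ˡ k c _)

ballotMoment-suc : ∀ (f : ℕ → ℤ) → f 0 ≡ + 0 → ∀ k → ballotMoment f (suc (suc k)) ≡ ballotMoment (smooth f) (suc k)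
ballotMoment-suc f f0 k =
  trans (sumFrom1-cong (suc (suc k)) (λ μ _ → cong (f (suc μ) *_) (ballot-suc (suc k) μ)))
        (sumFrom1-smooth-swap (suc k) f (ballot (suc k)) f0 (ballot-zero k) (λ μ → ballot-vanish))

smooth-pos : ∀ μ → smooth (λ μ → + μ) (suc μ) ≡ + 4 * + suc μ
smooth-pos μ rewrite ℤP.pos-+ 1 (suc μ) | ℤP.pos-+ 1 μ = collect (+ μ)
  where
    collect : ∀ x → x + + 2 * (+ 1 + x) + (+ 1 + (+ 1 + x)) ≡ + 4 * (+ 1 + x)
    collect = solve-∀

ballotMoment-pos : ∀ k → ballotMoment (λ μ → + μ) (suc k) ≡ + (4 ℕ.^ k)
ballotMoment-pos zero    = refl
ballotMoment-pos (suc k) = begin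
    ballotMoment (λ μ → + μ) (suc (suc k))
  ≡⟨ ballotMoment-suc (λ μ → + μ) refl k ⟩
    ballotMoment (smooth (λ μ → + μ)) (suc k)
  ≡⟨ ballotMoment-cong (smooth (λ μ → + μ)) (λ μ → + 4 * + μ) (suc k) smooth-pos ⟩
    ballotMoment (λ μ → + 4 * + μ) (suc k)
  ≡⟨ ballotMoment-*ˡ (+ 4) (λ μ → + μ) (suc k) ⟩
    + 4 * ballotMoment (λ μ → + μ) (suc k)
  ≡⟨ cong (+ 4 *_) (ballotMoment-pos k) ⟩
    + 4 * + (4 ℕ.^ k)
  ≡⟨ ℤP.pos-* 4 (4 ℕ.^ k) ⟨
    + (4 ℕ.^ suc k) ∎

weight : ℕ → ℤ
weight μ = + (2 ℕ.* μ ℕ.^ 3 ℕ.+ μ)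

smooth-weight : ∀ μ → smooth weight (suc μ) ≡ + 4 * weight (suc μ) + + 12 * + suc μ
smooth-weight μ = begin
    + w₀ + + 2 * + w₁ + + w₂
  ≡⟨ cong (λ z → + w₀ + z + + w₂) (ℤP.pos-* 2 w₁) ⟨
    + w₀ + + (2 ℕ.* w₁) + + w₂
  ≡⟨ cong (_+ + w₂) (ℤP.pos-+ w₀ (2 ℕ.* w₁)) ⟨
    + (w₀ ℕ.+ 2 ℕ.* w₁) + + w₂
  ≡⟨ ℤP.pos-+ (w₀ ℕ.+ 2 ℕ.* w₁) w₂ ⟨
    + (w₀ ℕ.+ 2 ℕ.* w₁ ℕ.+ w₂)
  ≡⟨ cong +_ (smoothed μ) ⟩
    + (4 ℕ.* w₁ ℕ.+ 12 ℕ.* suc μ)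
  ≡⟨ ℤP.pos-+ (4 ℕ.* w₁) (12 ℕ.* suc μ) ⟩
    + (4 ℕ.* w₁) + + (12 ℕ.* suc μ)
  ≡⟨ cong₂ _+_ (ℤP.pos-* 4 w₁) (ℤP.pos-* 12 (suc μ)) ⟩
    + 4 * + w₁ + + 12 * + suc μ ∎
  where
    w : ℕ → ℕ
    w m = 2 ℕ.* m ℕ.^ 3 ℕ.+ m
    w₀ = w μ
    w₁ = w (suc μ)
    w₂ = w (suc (suc μ))
    -- w written out, since the ring solver does not accept _^_.
    smoothed : ∀ m →
        (2 ℕ.* (m ℕ.* (m ℕ.* (m ℕ.* 1))) ℕ.+ m)
      ℕ.+ 2 ℕ.* (2 ℕ.* ((1 ℕ.+ m) ℕ.* ((1 ℕ.+ m) ℕ.* ((1 ℕ.+ m) ℕ.* 1))) ℕ.+ (1 ℕ.+ m))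
      ℕ.+ (2 ℕ.* ((2 ℕ.+ m) ℕ.* ((2 ℕ.+ m) ℕ.* ((2 ℕ.+ m) ℕ.* 1))) ℕ.+ (2 ℕ.+ m))
      ≡ 4 ℕ.* (2 ℕ.* ((1 ℕ.+ m) ℕ.* ((1 ℕ.+ m) ℕ.* ((1 ℕ.+ m) ℕ.* 1))) ℕ.+ (1 ℕ.+ m)) ℕ.+ 12 ℕ.* (1 ℕ.+ m)
    smoothed = ℕ-Solver.solve-∀

ballotMoment-weight-suc : ∀ k →
  ballotMoment weight (suc (suc k)) ≡ + 4 * ballotMoment weight (suc k) + + 12 * + (4 ℕ.^ k)
ballotMoment-weight-suc k = begin
    ballotMoment weight (suc (suc k))
  ≡⟨ ballotMoment-suc weight refl k ⟩
    ballotMoment (smooth weight) (suc k)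
  ≡⟨ ballotMoment-cong (smooth weight) (λ μ → + 4 * weight μ + + 12 * + μ) (suc k) smooth-weight ⟩
    ballotMoment (λ μ → + 4 * weight μ + + 12 * + μ) (suc k)
  ≡⟨ ballotMoment-+ (λ μ → + 4 * weight μ) (λ μ → + 12 * + μ) (suc k) ⟩
    ballotMoment (λ μ → + 4 * weight μ) (suc k) + ballotMoment (λ μ → + 12 * + μ) (suc k)
  ≡⟨ cong₂ _+_ (ballotMoment-*ˡ (+ 4) weight (suc k)) (ballotMoment-*ˡ (+ 12) (λ μ → + μ) (suc k)) ⟩
    + 4 * ballotMoment weight (suc k) + + 12 * ballotMoment (λ μ → + μ) (suc k)
  ≡⟨ cong (λ b → + 4 * ballotMoment weight (suc k) + + 12 * b) (ballotMoment-pos k) ⟩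
    + 4 * ballotMoment weight (suc k) + + 12 * + (4 ℕ.^ k) ∎

ballotMoment-weight : ∀ k → + 4 * ballotMoment weight (suc k) ≡ + 3 * (+ (4 ℕ.^ suc k) * + suc k)
ballotMoment-weight zero    = refl
ballotMoment-weight (suc k) = begin
    + 4 * ballotMoment weight (suc (suc k))
  ≡⟨ cong (+ 4 *_) (ballotMoment-weight-suc k) ⟩
    + 4 * (+ 4 * ballotMoment weight (suc k) + + 12 * + P)
  ≡⟨ ℤP.*-distribˡ-+ (+ 4) (+ 4 * ballotMoment weight (suc k)) (+ 12 * + P) ⟩
    + 4 * (+ 4 * ballotMoment weight (suc k)) + + 4 * (+ 12 * + P)
  ≡⟨ cong (λ a → + 4 * a + + 4 * (+ 12 * + P)) (ballotMoment-weight k) ⟩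
    + 4 * (+ 3 * (+ (4 ℕ.^ suc k) * + suc k)) + + 4 * (+ 12 * + P)
  ≡⟨ cong₂ (λ a b → + 4 * (+ 3 * (a * b)) + + 4 * (+ 12 * + P)) (ℤP.pos-* 4 P) (ℤP.pos-+ 1 k) ⟩
    + 4 * (+ 3 * ((+ 4 * + P) * (+ 1 + + k))) + + 4 * (+ 12 * + P)
  ≡⟨ collect (+ k) (+ P) ⟩
    + 3 * ((+ 4 * (+ 4 * + P)) * (+ 1 + (+ 1 + + k)))
  ≡⟨ cong₂ (λ a b → + 3 * (a * b)) 4^[2+k] [2+k] ⟨
    + 3 * (+ (4 ℕ.^ suc (suc k)) * + suc (suc k)) ∎
  where
    P = 4 ℕ.^ k
    collect : ∀ x q → + 4 * (+ 3 * ((+ 4 * q) * (+ 1 + x))) + + 4 * (+ 12 * q)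
                    ≡ + 3 * ((+ 4 * (+ 4 * q)) * (+ 1 + (+ 1 + x)))
    collect = solve-∀
    4^[2+k] : + (4 ℕ.^ suc (suc k)) ≡ + 4 * (+ 4 * + P)
    4^[2+k] = trans (ℤP.pos-* 4 (4 ℕ.^ suc k)) (cong (+ 4 *_) (ℤP.pos-* 4 P))
    [2+k] : + suc (suc k) ≡ + 1 + (+ 1 + + k)
    [2+k] = trans (ℤP.pos-+ 1 (suc k)) (cong (λ z → + 1 + z) (ℤP.pos-+ 1 k))

Seq : Set
Seq = ℕ → ℤ

shift : Seq → Seq
shift x k = x (suc k)

-- If x k sums g over the paths of length k, then V m x and H m x sum g over the reductions of
-- the paths of length m from a vertical resp. horizontal state (sumPaths-reduceV/H below).
mutual
  V : ℕ → Seq → ℤ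
  V zero    x = x 0
  V (suc m) x = + 2 * V m x + H m x

  H : ℕ → Seq → ℤ
  H zero          x = + 2 * x 0
  H (suc zero)    x = + 2 * x 1
  H (suc (suc m)) x = + 2 * H (suc m) x + V (suc m) (shift x)

AgreeUpTo : ℕ → Seq → Seq → Set
AgreeUpTo m x y = ∀ k → k ℕ.≤ m → x k ≡ y k

mutual
  V-local : ∀ m {x y} → AgreeUpTo m x y → V m x ≡ V m y
  V-local zero    eq = eq 0 z≤n
  V-local (suc m) eq = cong₂ (λ a b → + 2 * a + b) (V-local m (λ k k≤m → eq k (ℕP.m≤n⇒m≤1+n k≤m)))
                                                    (H-local m (λ k k≤m → eq k (ℕP.m≤n⇒m≤1+n k≤m)))

  H-local : ∀ m {x y} → AgreeUpTo m x y → H m x ≡ H m y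
  H-local zero          eq = cong (+ 2 *_) (eq 0 z≤n)
  H-local (suc zero)    eq = cong (+ 2 *_) (eq 1 ℕP.≤-refl)
  H-local (suc (suc m)) eq = cong₂ (λ a b → + 2 * a + b) (H-local (suc m) (λ k k≤ → eq k (ℕP.m≤n⇒m≤1+n k≤)))
                                                          (V-local (suc m) (λ k k≤ → eq (suc k) (s≤s k≤)))

H-suc-local : ∀ n {x y} → AgreeUpTo n (shift x) (shift y) → H (suc n) x ≡ H (suc n) y
H-suc-local zero    eq = cong (+ 2 *_) (eq 0 z≤n)
H-suc-local (suc n) eq = cong₂ (λ a b → + 2 * a + b) (H-suc-local n (λ k k≤ → eq k (ℕP.m≤n⇒m≤1+n k≤)))
                                                      (V-local (suc n) eq)

H-cong : ∀ m {x y : Seq} → (∀ k → x k ≡ y k) → H m x ≡ H m y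
H-cong m eq = H-local m (λ k _ → eq k)

private
  interchange : ∀ a b c d → + 2 * (a + b) + (c + d) ≡ (+ 2 * a + c) + (+ 2 * b + d)
  interchange = solve-∀

  factor : ∀ c a b → + 2 * (c * a) + c * b ≡ c * (+ 2 * a + b)
  factor = solve-∀

  commute : ∀ c a → + 2 * (c * a) ≡ c * (+ 2 * a)
  commute = solve-∀

mutual
  V-+ : ∀ m (x y : Seq) → V m (λ k → x k + y k) ≡ V m x + V m y
  V-+ zero    x y = refl
  V-+ (suc m) x y = trans (cong₂ (λ a b → + 2 * a + b) (V-+ m x y) (H-+ m x y))
                          (interchange (V m x) (V m y) (H m x) (H m y))

  H-+ : ∀ m (x y : Seq) → H m (λ k → x k + y k) ≡ H m x + H m y
  H-+ zero          x y = ℤP.*-distribˡ-+ (+ 2) (x 0) (y 0)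
  H-+ (suc zero)    x y = ℤP.*-distribˡ-+ (+ 2) (x 1) (y 1)
  H-+ (suc (suc m)) x y = trans (cong₂ (λ a b → + 2 * a + b) (H-+ (suc m) x y) (V-+ (suc m) (shift x) (shift y)))
                                (interchange (H (suc m) x) (H (suc m) y) (V (suc m) (shift x)) (V (suc m) (shift y)))

mutual
  V-*ˡ : ∀ m c (x : Seq) → V m (λ k → c * x k) ≡ c * V m x
  V-*ˡ zero    c x = refl
  V-*ˡ (suc m) c x = trans (cong₂ (λ a b → + 2 * a + b) (V-*ˡ m c x) (H-*ˡ m c x)) (factor c (V m x) (H m x))

  H-*ˡ : ∀ m c (x : Seq) → H m (λ k → c * x k) ≡ c * H m x
  H-*ˡ zero          c x = commute c (x 0)
  H-*ˡ (suc zero)    c x = commute c (x 1)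
  H-*ˡ (suc (suc m)) c x = trans (cong₂ (λ a b → + 2 * a + b) (H-*ˡ (suc m) c x) (V-*ˡ (suc m) c (shift x)))
                                 (factor c (H (suc m) x) (V (suc m) (shift x)))

H-zero : ∀ m → H m (λ _ → + 0) ≡ + 0
H-zero m = trans (H-*ˡ m (+ 0) (λ _ → + 0)) (ℤP.*-zeroˡ (H m (λ _ → + 0)))

H-sumFrom1 : ∀ m B (F : ℕ → Seq) → H m (λ k → sumFrom1 B (λ l → F l k)) ≡ sumFrom1 B (λ l → H m (F l))
H-sumFrom1 m zero    F = H-zero m
H-sumFrom1 m (suc B) F = trans (H-+ m (λ k → sumFrom1 B (λ l → F l k)) (F (suc B)))
                               (cong (_+ H m (F (suc B))) (H-sumFrom1 m B F))

H-rec : ∀ m x → H (suc (suc (suc m))) x ≡ + 4 * H (suc (suc m)) x - + 4 * H (suc m) x + H (suc m) (shift x)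
H-rec m x = eliminate-V (H (suc m) x) (V (suc m) (shift x)) (H (suc m) (shift x))
  where
    eliminate-V : ∀ a b c → + 2 * (+ 2 * a + b) + (+ 2 * b + c) ≡ + 4 * (+ 2 * a + b) - + 4 * a + c
    eliminate-V = solve-∀

ballotSeq : ℕ → Seq
ballotSeq m k = ballot k m

H-shift-ballotSeq : ∀ n m →
  H n (shift (ballotSeq (suc m))) ≡ H n (ballotSeq m) + + 2 * H n (ballotSeq (suc m)) + H n (ballotSeq (suc (suc m)))
H-shift-ballotSeq n m = begin
    H n (shift (ballotSeq (suc m)))
  ≡⟨ H-cong n (λ k → ballot-suc k m) ⟩
    H n (λ k → ballot k m + + 2 * ballot k (suc m) + ballot k (suc (suc m)))
  ≡⟨ H-+ n _ (ballotSeq (suc (suc m))) ⟩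
    H n (λ k → ballot k m + + 2 * ballot k (suc m)) + H n (ballotSeq (suc (suc m)))
  ≡⟨ cong (_+ H n (ballotSeq (suc (suc m))))
          (trans (H-+ n (ballotSeq m) _) (cong (λ z → H n (ballotSeq m) + z) (H-*ˡ n (+ 2) (ballotSeq (suc m))))) ⟩
    H n (ballotSeq m) + + 2 * H n (ballotSeq (suc m)) + H n (ballotSeq (suc (suc m))) ∎

-- H-rec with H (suc n) (ballotSeq m) replaced by + 2 * ballot (2 + n) (2 * m).
ballot-H-rec : ∀ k j →
  + 2 * ballot (suc (suc k)) (suc (suc j))
    ≡ + 4 * (+ 2 * ballot (suc k) (suc (suc j))) - + 4 * (+ 2 * ballot k (suc (suc j)))
      + (+ 2 * ballot k j + + 2 * (+ 2 * ballot k (suc (suc j))) + + 2 * ballot k (suc (suc (suc (suc j)))))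
ballot-H-rec k j rewrite ballot-suc k (suc j) | ballot-suc-suc k j =
  combine (ballot k j) (ballot k (1 ℕ.+ j)) (ballot k (2 ℕ.+ j)) (ballot k (3 ℕ.+ j)) (ballot k (4 ℕ.+ j))
  where
    combine : ∀ e₀ e₁ e₂ e₃ e₄ →
      + 2 * (e₀ + + 4 * e₁ + + 6 * e₂ + + 4 * e₃ + e₄)
        ≡ + 4 * (+ 2 * (e₁ + + 2 * e₂ + e₃)) - + 4 * (+ 2 * e₂) + (+ 2 * e₀ + + 2 * (+ 2 * e₂) + + 2 * e₄)
    combine = solve-∀

private
  4≤2*[2+j] : ∀ j → 4 ℕ.≤ 2 ℕ.* suc (suc j)
  4≤2*[2+j] j = ℕP.*-monoʳ-≤ 2 (s≤s (s≤s z≤n))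

H-ballot : ∀ n m → H (suc n) (ballotSeq m) ≡ + 2 * ballot (suc (suc n)) (2 ℕ.* m)
H-ballot n zero = begin
    H (suc n) (ballotSeq 0)
  ≡⟨ H-suc-local n (λ k _ → ballot-zero k) ⟩
    H (suc n) (λ _ → + 0)
  ≡⟨ H-zero (suc n) ⟩
    + 0
  ≡⟨ cong (+ 2 *_) (ballot-zero (suc n)) ⟨
    + 2 * ballot (suc (suc n)) 0 ∎
H-ballot zero (suc zero) = refl
H-ballot zero (suc (suc j))
  rewrite ballot-vanish {1} {suc (suc j)} (s≤s (s≤s z≤n))
        | ballot-vanish {2} {2 ℕ.* suc (suc j)} (ℕP.≤-trans (ℕP.n≤1+n 3) (4≤2*[2+j] j))
  = refl
H-ballot (suc zero) (suc zero) = refl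
H-ballot (suc zero) (suc (suc j))
  rewrite ballot-vanish {1} {suc (suc j)} (s≤s (s≤s z≤n))
        | ballot-vanish {3} {2 ℕ.* suc (suc j)} (4≤2*[2+j] j)
  = refl
H-ballot (suc (suc n)) (suc m) = begin
    H (3 ℕ.+ n) (b (suc m))
  ≡⟨ H-rec n (b (suc m)) ⟩
    + 4 * H (2 ℕ.+ n) (b (suc m)) - + 4 * H (suc n) (b (suc m)) + H (suc n) (shift (b (suc m)))
  ≡⟨ cong (λ z → + 4 * H (2 ℕ.+ n) (b (suc m)) - + 4 * H (suc n) (b (suc m)) + z)
          (H-shift-ballotSeq (suc n) m) ⟩
    + 4 * H (2 ℕ.+ n) (b (suc m)) - + 4 * H (suc n) (b (suc m))
      + (H (suc n) (b m) + + 2 * H (suc n) (b (suc m)) + H (suc n) (b (2 ℕ.+ m)))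
  ≡⟨ cong₂ (λ u v → + 4 * u - + 4 * v + (H (suc n) (b m) + + 2 * v + H (suc n) (b (2 ℕ.+ m))))
           (H-ballot (suc n) (suc m)) (H-ballot n (suc m)) ⟩
    + 4 * (+ 2 * D₃ (2 ℕ.* suc m)) - + 4 * (+ 2 * D₂ (2 ℕ.* suc m))
      + (H (suc n) (b m) + + 2 * (+ 2 * D₂ (2 ℕ.* suc m)) + H (suc n) (b (2 ℕ.+ m)))
  ≡⟨ cong₂ (λ u v → + 4 * (+ 2 * D₃ (2 ℕ.* suc m)) - + 4 * (+ 2 * D₂ (2 ℕ.* suc m))
                     + (u + + 2 * (+ 2 * D₂ (2 ℕ.* suc m)) + v))
           (H-ballot n m) (H-ballot n (suc (suc m))) ⟩
    + 4 * (+ 2 * D₃ (2 ℕ.* suc m)) - + 4 * (+ 2 * D₂ (2 ℕ.* suc m))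
      + (+ 2 * D₂ (2 ℕ.* m) + + 2 * (+ 2 * D₂ (2 ℕ.* suc m)) + + 2 * D₂ (2 ℕ.* suc (suc m)))
  ≡⟨ cong₂ (λ i i′ → + 4 * (+ 2 * D₃ i) - + 4 * (+ 2 * D₂ i)
                      + (+ 2 * D₂ (2 ℕ.* m) + + 2 * (+ 2 * D₂ i) + + 2 * D₂ i′))
           (ℕP.*-suc 2 m) 2*[2+m] ⟩
    + 4 * (+ 2 * D₃ (2 ℕ.+ 2 ℕ.* m)) - + 4 * (+ 2 * D₂ (2 ℕ.+ 2 ℕ.* m))
      + (+ 2 * D₂ (2 ℕ.* m) + + 2 * (+ 2 * D₂ (2 ℕ.+ 2 ℕ.* m)) + + 2 * D₂ (4 ℕ.+ 2 ℕ.* m))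
  ≡⟨ ballot-H-rec (2 ℕ.+ n) (2 ℕ.* m) ⟨
    + 2 * ballot (4 ℕ.+ n) (2 ℕ.+ 2 ℕ.* m)
  ≡⟨ cong (λ i → + 2 * ballot (4 ℕ.+ n) i) (ℕP.*-suc 2 m) ⟨
    + 2 * ballot (4 ℕ.+ n) (2 ℕ.* suc m) ∎
  where
    b = ballotSeq
    D₂ = ballot (2 ℕ.+ n)
    D₃ = ballot (3 ℕ.+ n)
    2*[2+m] : 2 ℕ.* suc (suc m) ≡ 4 ℕ.+ 2 ℕ.* m
    2*[2+m] = trans (ℕP.*-suc 2 (suc m)) (cong (2 ℕ.+_) (ℕP.*-suc 2 m))

ballotSum : ℕ → Seq
ballotSum r n = sumFrom1 n (summand n r)

H-ballotSum : ∀ r n → H (suc n) (ballotSum r) ≡ + 2 * ballotSum (suc r) (suc (suc n))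
H-ballotSum r n = begin
    H (suc n) (ballotSum r)
  ≡⟨ H-local (suc n) extend ⟩
    H (suc n) (λ k → sumFrom1 N (λ l → weight l * ballotSeq (2 ℕ.^ r ℕ.* l) k))
  ≡⟨ H-sumFrom1 (suc n) N (λ l k → weight l * ballotSeq (2 ℕ.^ r ℕ.* l) k) ⟩
    sumFrom1 N (λ l → H (suc n) (λ k → weight l * ballotSeq (2 ℕ.^ r ℕ.* l) k))
  ≡⟨ sumFrom1-cong N (λ l _ → trans (H-*ˡ (suc n) (weight (suc l)) _)
                                    (cong (weight (suc l) *_) (H-ballot n (2 ℕ.^ r ℕ.* suc l)))) ⟩
    sumFrom1 N (λ l → weight l * (+ 2 * ballot N (2 ℕ.* (2 ℕ.^ r ℕ.* l))))
  ≡⟨ sumFrom1-cong N (λ l _ → trans (sym (commute (weight (suc l)) _))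
                                    (cong (λ i → + 2 * (weight (suc l) * ballot N i))
                                          (sym (ℕP.*-assoc 2 (2 ℕ.^ r) (suc l))))) ⟩
    sumFrom1 N (λ l → + 2 * summand N (suc r) l)
  ≡⟨ sumFrom1-*ˡ N (+ 2) (summand N (suc r)) ⟩
    + 2 * ballotSum (suc r) N ∎
  where
    N = suc (suc n)
    -- A term with l > k vanishes because 2^r l ≥ l > k.
    extend : AgreeUpTo (suc n) (ballotSum r)
                       (λ k → sumFrom1 N (λ l → weight l * ballotSeq (2 ℕ.^ r ℕ.* l) k))
    extend k k≤1+n = sym (sumFrom1-tail _ (ℕP.m≤n⇒m≤1+n k≤1+n) λ l k<l →
      trans (cong (weight l *_) (ballot-vanish (ℕP.<-≤-trans k<l (ℕP.m≤n*m l (2 ℕ.^ r) {{ℕP.m^n≢0 2 r}}))))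
            (ℤP.*-zeroʳ (weight l)))

sumCons : (Path → ℤ) → Path → ℤ
sumCons g p = g (U ∷ p) + g (R ∷ p) + g (D ∷ p) + g (L ∷ p)

sumPaths : ℕ → (Path → ℤ) → ℤ
sumPaths zero    g = g []
sumPaths (suc n) g = sumPaths n (sumCons g)

pathSums : (Path → ℤ) → Seq
pathSums g k = sumPaths k g

sumPaths-cong : ∀ n {f g : Path → ℤ} → (∀ p → f p ≡ g p) → sumPaths n f ≡ sumPaths n g
sumPaths-cong zero    eq = eq []
sumPaths-cong (suc n) eq =
  sumPaths-cong n (λ p → cong₂ _+_ (cong₂ _+_ (cong₂ _+_ (eq (U ∷ p)) (eq (R ∷ p))) (eq (D ∷ p))) (eq (L ∷ p)))

sumPaths-cong-∷ : ∀ n (f g : Path → ℤ) → (∀ y q → f (y ∷ q) ≡ g (y ∷ q)) →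
  sumPaths (suc n) f ≡ sumPaths (suc n) g
sumPaths-cong-∷ n f g eq =
  sumPaths-cong n (λ p → cong₂ _+_ (cong₂ _+_ (cong₂ _+_ (eq U p) (eq R p)) (eq D p)) (eq L p))

sumPaths-+ : ∀ n (f g : Path → ℤ) → sumPaths n (λ p → f p + g p) ≡ sumPaths n f + sumPaths n g
sumPaths-+ zero    f g = refl
sumPaths-+ (suc n) f g = trans (sumPaths-cong n (λ p → regroup (f (U ∷ p)) (g (U ∷ p)) (f (R ∷ p)) (g (R ∷ p))
                                                                 (f (D ∷ p)) (g (D ∷ p)) (f (L ∷ p)) (g (L ∷ p))))
                               (sumPaths-+ n (sumCons f) (sumCons g))
  where
    regroup : ∀ a a′ b b′ c c′ d d′ →
      a + a′ + (b + b′) + (c + c′) + (d + d′) ≡ (a + b + c + d) + (a′ + b′ + c′ + d′)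
    regroup = solve-∀

sumPaths-*ˡ : ∀ n c (f : Path → ℤ) → sumPaths n (λ p → c * f p) ≡ c * sumPaths n f
sumPaths-*ˡ zero    c f = refl
sumPaths-*ˡ (suc n) c f = trans (sumPaths-cong n (λ p → distrib c (f (U ∷ p)) (f (R ∷ p)) (f (D ∷ p)) (f (L ∷ p))))
                                (sumPaths-*ˡ n c (sumCons f))
  where
    distrib : ∀ c a b d e → c * a + c * b + c * d + c * e ≡ c * (a + b + d + e)
    distrib = solve-∀

sumPaths-map-rotCW : ∀ n (g : Path → ℤ) → sumPaths n (g ∘ map rotCW) ≡ sumPaths n g
sumPaths-map-rotCW zero    g = refl
sumPaths-map-rotCW (suc n) g =
  trans (sumPaths-map-rotCW n (λ q → g (R ∷ q) + g (D ∷ q) + g (L ∷ q) + g (U ∷ q)))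
        (sumPaths-cong n (λ q → rotate (g (U ∷ q)) (g (R ∷ q)) (g (D ∷ q)) (g (L ∷ q))))
  where
    rotate : ∀ u r d l → r + d + l + u ≡ u + r + d + l
    rotate = solve-∀

sumPaths-length : ∀ n (h : ℕ → ℤ) → sumPaths n (h ∘ length) ≡ + (4 ℕ.^ n) * h n
sumPaths-length zero    h = sym (ℤP.*-identityˡ (h 0))
sumPaths-length (suc n) h = begin
    sumPaths n (λ p → h (suc (length p)) + h (suc (length p)) + h (suc (length p)) + h (suc (length p)))
  ≡⟨ sumPaths-cong n (λ p → four-times (h (suc (length p)))) ⟩
    sumPaths n (λ p → + 4 * h (suc (length p)))
  ≡⟨ sumPaths-*ˡ n (+ 4) (h ∘ suc ∘ length) ⟩
    + 4 * sumPaths n (h ∘ suc ∘ length)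
  ≡⟨ cong (+ 4 *_) (sumPaths-length n (h ∘ suc)) ⟩
    + 4 * (+ (4 ℕ.^ n) * h (suc n))
  ≡⟨ ℤP.*-assoc (+ 4) (+ (4 ℕ.^ n)) (h (suc n)) ⟨
    + 4 * + (4 ℕ.^ n) * h (suc n)
  ≡⟨ cong (_* h (suc n)) (ℤP.pos-* 4 (4 ℕ.^ n)) ⟨
    + (4 ℕ.^ suc n) * h (suc n) ∎
  where
    four-times : ∀ a → a + a + a + a ≡ + 4 * a
    four-times = solve-∀

sum-map-concatMap : ∀ {A B : Set} (f : B → ℕ) (F : A → List B) xs →
  sum (map f (concatMap F xs)) ≡ sum (map (λ x → sum (map f (F x))) xs)
sum-map-concatMap f F []       = refl
sum-map-concatMap f F (x ∷ xs) = begin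
    sum (map f (F x ++ concatMap F xs))
  ≡⟨ cong sum (map-++ f (F x) (concatMap F xs)) ⟩
    sum (map f (F x) ++ map f (concatMap F xs))
  ≡⟨ sum-++ (map f (F x)) (map f (concatMap F xs)) ⟩
    sum (map f (F x)) ℕ.+ sum (map f (concatMap F xs))
  ≡⟨ cong (sum (map f (F x)) ℕ.+_) (sum-map-concatMap f F xs) ⟩
    sum (map f (F x)) ℕ.+ sum (map (λ x → sum (map f (F x))) xs) ∎

pos-sum : ∀ ns → + sum ns ≡ foldr _+_ (+ 0) (map +_ ns)
pos-sum []       = refl
pos-sum (n ∷ ns) = trans (ℤP.pos-+ n (sum ns)) (cong (λ z → + n + z) (pos-sum ns))

sum-allPaths : ∀ n (f : Path → ℕ) → + sum (map f (allPaths n)) ≡ sumPaths n (λ p → + f p)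
sum-allPaths zero    f = cong +_ (ℕP.+-identityʳ (f []))
sum-allPaths (suc n) f = begin
    + sum (map f (concatMap extensions (allPaths n)))
  ≡⟨ cong +_ (sum-map-concatMap f extensions (allPaths n)) ⟩
    + sum (map (λ p → sum (map f (extensions p))) (allPaths n))
  ≡⟨ sum-allPaths n (λ p → sum (map f (extensions p))) ⟩
    sumPaths n (λ p → + sum (map f (extensions p)))
  ≡⟨ sumPaths-cong n (λ p → trans (pos-sum (map f (extensions p)))
                                   (reassoc (+ f (U ∷ p)) (+ f (R ∷ p)) (+ f (D ∷ p)) (+ f (L ∷ p)))) ⟩
    sumPaths n (sumCons (λ p → + f p)) ∎
  where
    extensions : Path → List Path
    extensions p = (U ∷ p) ∷ (R ∷ p) ∷ (D ∷ p) ∷ (L ∷ p) ∷ []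
    reassoc : ∀ a b c d → a + (b + (c + (d + + 0))) ≡ a + b + c + d
    reassoc = solve-∀

-- Steps (2)-(4) of Φ_L, from a vertical resp. horizontal (with first step h) scanning state.
reduceV : Path → Path
reduceV p = inV (fixLast p)

reduceH : Step → Path → Path
reduceH h p = inH h (fixLast p)

sumH : (Path → ℤ) → Path → ℤ
sumH g p = g (reduceH R p) + g (reduceH L p)

private
  a+a≡2a : ∀ a → a + a ≡ + 2 * a
  a+a≡2a = solve-∀

  collect-2a : ∀ a b c → a + b + a + c ≡ + 2 * a + (b + c)
  collect-2a = solve-∀

sumCons-reduceV : ∀ (g : Path → ℤ) p → sumCons (g ∘ reduceV) p ≡ + 2 * g (reduceV p) + sumH g p
sumCons-reduceV g []      = collect-2a (g []) (g []) (g [])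
sumCons-reduceV g (y ∷ q) = collect-2a (g (reduceV (y ∷ q))) (g (reduceH R (y ∷ q))) (g (reduceH L (y ∷ q)))

-- A vertical step U or D ends the horizontal run: the segments (→,↑), (←,↑), (→,↓), (←,↓)
-- become R, U, D, L, one step of each.
sumCons-sumH : ∀ (g : Path → ℤ) y q →
  sumCons (sumH g) (y ∷ q) ≡ + 2 * sumH g (y ∷ q) + sumCons g (reduceV (y ∷ q))
sumCons-sumH g y q = collect (sumH g (y ∷ q)) (g (U ∷ v)) (g (R ∷ v)) (g (D ∷ v)) (g (L ∷ v))
  where
    v = reduceV (y ∷ q)
    collect : ∀ s u r d l → r + u + s + (d + l) + s ≡ + 2 * s + (u + r + d + l)
    collect = solve-∀

mutual
  sumPaths-reduceV : ∀ m (g : Path → ℤ) → sumPaths m (g ∘ reduceV) ≡ V m (pathSums g)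
  sumPaths-reduceV zero    g = refl
  sumPaths-reduceV (suc m) g = begin
      sumPaths m (sumCons (g ∘ reduceV))
    ≡⟨ sumPaths-cong m (sumCons-reduceV g) ⟩
      sumPaths m (λ p → + 2 * g (reduceV p) + sumH g p)
    ≡⟨ sumPaths-+ m (λ p → + 2 * g (reduceV p)) (sumH g) ⟩
      sumPaths m (λ p → + 2 * g (reduceV p)) + sumPaths m (sumH g)
    ≡⟨ cong₂ _+_ (trans (sumPaths-*ˡ m (+ 2) (g ∘ reduceV)) (cong (+ 2 *_) (sumPaths-reduceV m g)))
                 (sumPaths-reduceH m g) ⟩
      V (suc m) (pathSums g) ∎

  sumPaths-reduceH : ∀ m (g : Path → ℤ) → sumPaths m (sumH g) ≡ H m (pathSums g)
  sumPaths-reduceH zero g = a+a≡2a (g [])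
  sumPaths-reduceH (suc zero) g = collect (g (U ∷ [])) (g (R ∷ [])) (g (D ∷ [])) (g (L ∷ []))
    where
      collect : ∀ u r d l → r + u + (d + l) + (d + l) + (r + u) ≡ + 2 * (u + r + d + l)
      collect = solve-∀
  sumPaths-reduceH (suc (suc m)) g = begin
      sumPaths (suc (suc m)) (sumH g)
    ≡⟨ sumPaths-cong-∷ m (sumCons (sumH g)) (λ p → + 2 * sumH g p + sumCons g (reduceV p)) (sumCons-sumH g) ⟩
      sumPaths (suc m) (λ p → + 2 * sumH g p + sumCons g (reduceV p))
    ≡⟨ sumPaths-+ (suc m) (λ p → + 2 * sumH g p) (sumCons g ∘ reduceV) ⟩
      sumPaths (suc m) (λ p → + 2 * sumH g p) + sumPaths (suc m) (sumCons g ∘ reduceV)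
    ≡⟨ cong₂ _+_ (trans (sumPaths-*ˡ (suc m) (+ 2) (sumH g)) (cong (+ 2 *_) (sumPaths-reduceH (suc m) g)))
                 (sumPaths-reduceV (suc m) (sumCons g)) ⟩
      H (suc (suc m)) (pathSums g) ∎

fringe-[] : ∀ r → fringe r [] ≡ 0
fringe-[] zero    = refl
fringe-[] (suc r) = refl

-- First steps U and D are rotated to R and L, so Φ_L of U∷p, R∷p, D∷p, L∷p is read off
-- reduceH R (rotated p), reduceH R p, reduceH L (rotated p), reduceH L p.
sumCons-fringe : ∀ r p →
  sumCons (λ q → + fringe (suc r) q) p ≡ sumH (λ q → + fringe r q) (map rotCW p) + sumH (λ q → + fringe r q) p
sumCons-fringe r [] rewrite fringe-[] r = refl
sumCons-fringe r (y ∷ q) = regroup (g (reduceH R (map rotCW (y ∷ q)))) (g (reduceH R (y ∷ q)))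
                                   (g (reduceH L (map rotCW (y ∷ q)))) (g (reduceH L (y ∷ q)))
  where
    g : Path → ℤ
    g p = + fringe r p
    regroup : ∀ a b c d → a + b + c + d ≡ (a + c) + (b + d)
    regroup = solve-∀

fringeSum : ℕ → Seq
fringeSum r n = sumPaths n (λ p → + fringe r p)

fringeSum-suc : ∀ r n → fringeSum (suc r) (suc (suc n)) ≡ + 2 * H (suc n) (fringeSum r)
fringeSum-suc r n = begin
    sumPaths (suc n) (sumCons (λ q → + fringe (suc r) q))
  ≡⟨ sumPaths-cong (suc n) (sumCons-fringe r) ⟩
    sumPaths (suc n) (λ p → sumH g (map rotCW p) + sumH g p)
  ≡⟨ sumPaths-+ (suc n) (sumH g ∘ map rotCW) (sumH g) ⟩
    sumPaths (suc n) (sumH g ∘ map rotCW) + sumPaths (suc n) (sumH g)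
  ≡⟨ cong (_+ sumPaths (suc n) (sumH g)) (sumPaths-map-rotCW (suc n) (sumH g)) ⟩
    sumPaths (suc n) (sumH g) + sumPaths (suc n) (sumH g)
  ≡⟨ a+a≡2a (sumPaths (suc n) (sumH g)) ⟩
    + 2 * sumPaths (suc n) (sumH g)
  ≡⟨ cong (+ 2 *_) (sumPaths-reduceH (suc n) g) ⟩
    + 2 * H (suc n) (fringeSum r) ∎
  where
    g : Path → ℤ
    g p = + fringe r p

fringe-formula : ∀ r n → + 3 * fringeSum r n ≡ + (4 ℕ.^ (r ℕ.+ 1)) * ballotSum r n
fringe-formula zero zero    = refl
fringe-formula zero (suc k) = begin
    + 3 * fringeSum 0 (suc k)
  ≡⟨ cong (+ 3 *_) (sumPaths-length (suc k) (λ m → + m)) ⟩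
    + 3 * (+ (4 ℕ.^ suc k) * + suc k)
  ≡⟨ ballotMoment-weight k ⟨
    + 4 * ballotMoment weight (suc k)
  ≡⟨ cong (+ 4 *_) (sumFrom1-cong (suc k) (λ μ _ → cong (λ i → weight (suc μ) * ballot (suc k) i)
                                                            (sym (ℕP.+-identityʳ (suc μ))))) ⟩
    + 4 * ballotSum 0 (suc k) ∎
fringe-formula (suc r) zero = sym (ℤP.*-zeroʳ (+ (4 ℕ.^ (suc r ℕ.+ 1))))
fringe-formula (suc r) (suc zero) =
  sym (trans (cong (λ d → + (4 ℕ.^ (suc r ℕ.+ 1)) * (+ 0 + weight 1 * d)) (ballot-vanish 1<2^[1+r]))
             (ℤP.*-zeroʳ (+ (4 ℕ.^ (suc r ℕ.+ 1)))))
  where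
    1<2^[1+r] : 1 ℕ.< 2 ℕ.^ suc r ℕ.* 1
    1<2^[1+r] = subst (1 ℕ.<_) (sym (ℕP.*-identityʳ _)) (ℕP.*-monoʳ-≤ 2 (ℕP.m^n>0 2 r))
fringe-formula (suc r) (suc (suc n)) = begin
    + 3 * fringeSum (suc r) (suc (suc n))
  ≡⟨ cong (+ 3 *_) (fringeSum-suc r n) ⟩
    + 3 * (+ 2 * H (suc n) (fringeSum r))
  ≡⟨ swap (H (suc n) (fringeSum r)) ⟩
    + 2 * (+ 3 * H (suc n) (fringeSum r))
  ≡⟨ cong (+ 2 *_) (H-*ˡ (suc n) (+ 3) (fringeSum r)) ⟨
    + 2 * H (suc n) (λ k → + 3 * fringeSum r k)
  ≡⟨ cong (+ 2 *_) (H-cong (suc n) (fringe-formula r)) ⟩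
    + 2 * H (suc n) (λ k → + q * ballotSum r k)
  ≡⟨ cong (+ 2 *_) (H-*ˡ (suc n) (+ q) (ballotSum r)) ⟩
    + 2 * (+ q * H (suc n) (ballotSum r))
  ≡⟨ cong (λ z → + 2 * (+ q * z)) (H-ballotSum r n) ⟩
    + 2 * (+ q * (+ 2 * ballotSum (suc r) (suc (suc n))))
  ≡⟨ collect (+ q) (ballotSum (suc r) (suc (suc n))) ⟩
    + 4 * + q * ballotSum (suc r) (suc (suc n))
  ≡⟨ cong (_* ballotSum (suc r) (suc (suc n))) (ℤP.pos-* 4 q) ⟨
    + (4 ℕ.^ (suc r ℕ.+ 1)) * ballotSum (suc r) (suc (suc n)) ∎
  where
    q = 4 ℕ.^ (r ℕ.+ 1)
    swap : ∀ a → + 3 * (+ 2 * a) ≡ + 2 * (+ 3 * a)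
    swap = solve-∀
    collect : ∀ x s → + 2 * (x * (+ 2 * s)) ≡ + 4 * x * s
    collect = solve-∀

proposition3p11 : (r n : ℕ) → 1 ℕ.≤ n →
    + 3 * + totalFringe n r ≡ + (4 ℕ.^ (r ℕ.+ 1)) * sumFrom1 n (summand n r)
proposition3p11 r n _ = trans (cong (+ 3 *_) (sum-allPaths n (fringe r))) (fringe-formula r n)
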